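{- Let $\mathfrak{T}=\langle\mathcal{M},\mathcal{E}\rangle$ be a constrained equational theory over a signature $\Sigma$. For any set $X\subseteq\mathcal{V}_{th}$ and logical constraint $\varphi$ with $\mathrm{Var}(\varphi)\subseteq X$, the binary relation on terms relating $s$ and $t$ iff $\mathfrak{T}\models_{\mathrm{cec}}\Pi X.\ s\approx t\ [\varphi]$ is a congruence relation over $\Sigma$, i.e. it is reflexive, symmetric and transitive, and whenever $\mathfrak{T}\models_{\mathrm{cec}}\Pi X.\ s_i\approx t_i\ [\varphi]$ for $1\le i\le n$ and $f\in\mathcal{F}$, then $\mathfrak{T}\models_{\mathrm{cec}}\Pi X.\ f(s_1,\dots,s_n)\approx f(t_1,\dots,t_n)\ [\varphi]$.
   Context: Signature $\Sigma$: sorts $\mathcal{S} = \mathcal{S}_{th} \uplus \mathcal{S}_{te}$ (theory/term sorts), function symbols $\mathcal{F} = \mathcal{F}_{th} \uplus \mathcal{F}_{te}$ with sort declarations; theory symbols have only theory sorts. Sorted variables $\mathcal{V} = \mathcal{V}_{th}\uplus\mathcal{V}_{te}$. A model $\mathcal{M} = \langle \mathcal{I},\mathcal{J}\rangle$ assigns a non-empty set $\mathcal{I}(\tau)$ to each theory sort and a function $\mathcal{J}(f)$ to each $f \in\mathcal{F}_{th}$; for each theory sort $\tau$ a set $\mathrm{Val}_\tau\subseteq\mathcal{F}_{th}$ of constants ("values") is mapped bijectively onto $\mathcal{I}(\tau)$ by $\mathcal{J}$; $\mathrm{Val}=\bigcup_\tau\mathrm{Val}_\tau$. Sort $\mathsf{Bool}$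 with $\mathcal{I}(\mathsf{Bool})=\{\mathsf{true},\mathsf{false}\}$, standard connectives and equality symbols. Logical constraints: terms of $\mathcal{T}(\mathcal{F}_{th},\mathcal{V})$ of sort $\mathsf{Bool}$; $\models_\mathcal{M}\varphi$ means true under every valuation. Substitutions: sort-preserving, finite domain; $\mathcal{V}\mathrm{Dom}(\sigma)=\{x\in\mathrm{Dom}(\sigma)\mid\sigma(x)\in\mathrm{Val}\}$; $\sigma$ is $X$-valued if $X\subseteq\mathcal{V}\mathrm{Dom}(\sigma)$. Calculation step $s\to_{calc}t$: $s=C[f(c_1,\dots,c_n)]$, $t=C[c_0]$, $f\in\mathcal{F}_{th}\setminus\mathrm{Val}$, $c_i\in\mathrm{Val}$, $c_0=\mathcal{J}(f)(c_1,\dots,c_n)$; $\leftrightarrow_{calc}$ its symmetric closure. A CE $\Pi X.\ s\approx t\ [\varphi]$: terms of equal sort, logical constraint $\varphi$, $X\subseteq\mathcal{V}_{th}$ with $\mathrm{Var}(\varphi)\subseteq X$. Theory $\langle\mathcal{M},\mathcal{E}\rangle$: $\mathcal{E}$ a set of CEs. $s\leftrightarrow_{rule,\mathcal{E}}t$ iff $s=C[\ell\sigma]$, $t=C[r\sigma]$ (or vice versa) for some $\Pi X.\ \ell\approx r\ [\varphi]\in\mathcal{E}$ and $X$-valued $\sigma$ with $\models_\mathcal{M}\varphi\sigma$; $\leftrightarrow_\mathcal{E}=\leftrightarrow_{calc}\cup\leftrightarrow_{rule,\mathcal{E}}$. $\mathfrak{T}\models_{\mathrm{cec}}\Pi X.\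 s\approx t\ [\varphi]$ iff $s\sigma\leftrightarrow^*_\mathcal{E}t\sigma$ for all $X$-valued $\sigma$ with $\models_\mathcal{M}\varphi\sigma$. -}

module Defs where

open import Data.Bool using (Bool; true)
open import Data.List using (List; []; _∷_; map)
open import Data.List.Relation.Unary.All using (All)
open import Data.List.Membership.Propositional using (_∈_)
open import Data.Product using (Σ; Σ-syntax; _×_; _,_; ∃)
open import Data.Sum using (_⊎_; inj₁; inj₂)
open import Function.Bundles using (_↔_; Inverse)
open import Relation.Nullary using (¬_)
open import Relation.Binary.PropositionalEquality using (_≡_; _≢_; subst; sym)
open import Relation.Binary.Construct.Closure.ReflexiveTransitive using (Star)

-- Many-sorted signature  Σ = (S_th ⊎ S_te , F_th ⊎ F_te , V_th ⊎ V_te).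
-- Theory symbols have only theory sorts (enforced by their typing).

record Signature : Set₁ where
  field
    ThSort : Set
    TeSort : Set
    boolS  : ThSort
    FTh    : Set
    FTe    : Set
    thArgs : FTh → List ThSort
    thRes  : FTh → ThSort
    teArgs : FTe → List (ThSort ⊎ TeSort)
    teRes  : FTe → ThSort ⊎ TeSort
    VTh    : ThSort → Set
    VTe    : TeSort → Set

record Model (Sig : Signature) : Set₁ where
  open Signature Sig
  field
    I       : ThSort → Set
    inhab   : (τ : ThSort) → I τ
    J       : (f : FTh) → All I (thArgs f) → I (thRes f)
    isVal   : FTh → Set
    valConst : ∀ {c} → isVal c → thArgs c ≡ []
    -- J restricted to Val_τ is a bijection onto I(τ)
    valInj  : ∀ {c d} (vc : isVal c) (vd : isVal d) (r : thRes c ≡ thRes d) →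
              subst I r (J c (subst (All I) (sym (valConst vc)) All.[])) ≡
                J d (subst (All I) (sym (valConst vd)) All.[]) → c ≡ d
    valSurj : ∀ (τ : ThSort) (a : I τ) → Σ[ c ∈ FTh ] Σ[ vc ∈ isVal c ]
              Σ[ r ∈ thRes c ≡ τ ]
                subst I r (J c (subst (All I) (sym (valConst vc)) All.[])) ≡ a
    boolIso : I boolS ↔ Bool

module Terms (Sig : Signature) where
  open Signature Sig

  Sort : Set
  Sort = ThSort ⊎ TeSort

  Fun : Set
  Fun = FTh ⊎ FTe

  args : Fun → List Sort
  args (inj₁ f) = map inj₁ (thArgs f)
  args (inj₂ g) = teArgs g

  res : Fun → Sort
  res (inj₁ f) = inj₁ (thRes f)
  res (inj₂ g) = teRes g

  data Var : Sort → Set where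
    thv : ∀ {τ} → VTh τ → Var (inj₁ τ)
    tev : ∀ {κ} → VTe κ → Var (inj₂ κ)

  data Term : Sort → Set
  data Terms : List Sort → Set

  data Term where
    var : ∀ {s} → Var s → Term s
    app : (f : Fun) → Terms (args f) → Term (res f)

  data Terms where
    []  : Terms []
    _∷_ : ∀ {s ss} → Term s → Terms ss → Terms (s ∷ ss)

  record Subst : Set where
    field
      apply  : ∀ {s} → Var s → Term s
      dom    : List (Σ Sort Var)
      finite : ∀ {s} (x : Var s) → apply x ≢ var x → (s , x) ∈ dom
  open Subst public using () renaming (apply to _·_)

  _⟨_⟩  : ∀ {s} → Term s → Subst → Term s
  _⟨_⟩* : ∀ {ss} → Terms ss → Subst → Terms ss
  var x    ⟨ σ ⟩ = σ · x
  app f ts ⟨ σ ⟩ = app f (ts ⟨ σ ⟩*)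
  []       ⟨ σ ⟩* = []
  (t ∷ ts) ⟨ σ ⟩* = (t ⟨ σ ⟩) ∷ (ts ⟨ σ ⟩*)

  data IsThTerm : ∀ {s} → Term s → Set
  data IsThTerms : ∀ {ss} → Terms ss → Set
  data IsThTerm where
    tvar : ∀ {τ} (x : VTh τ) → IsThTerm (var (thv x))
    tapp : ∀ (f : FTh) {ts} → IsThTerms ts → IsThTerm (app (inj₁ f) ts)
  data IsThTerms where
    []  : IsThTerms []
    _∷_ : ∀ {s ss} {t : Term s} {ts : Terms ss} →
          IsThTerm t → IsThTerms ts → IsThTerms (t ∷ ts)

  data Occurs {s′} (x : Var s′) : ∀ {s} → Term s → Set
  data OccursArgs {s′} (x : Var s′) : ∀ {ss} → Terms ss → Set
  data Occurs {s′} x where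
    here : Occurs x (var x)
    inArgs : ∀ f {ts} → OccursArgs x ts → Occurs x (app f ts)
  data OccursArgs {s′} x where
    hd : ∀ {s ss} {t : Term s} {ts : Terms ss} → Occurs x t → OccursArgs x (t ∷ ts)
    tl : ∀ {s ss} {t : Term s} {ts : Terms ss} → OccursArgs x ts → OccursArgs x (t ∷ ts)

  VarSet : Set₁
  VarSet = (τ : ThSort) → VTh τ → Set

  VarsIn_⊆_ : Term (inj₁ boolS) → VarSet → Set
  VarsIn φ ⊆ X = ∀ {τ} (x : VTh τ) → Occurs (thv x) φ → X τ x

  TRel : Set₁
  TRel = ∀ {s} → Term s → Term s → Set

  data Ctx (R : TRel) : TRel
  data CtxArgs (R : TRel) : ∀ {ss} → Terms ss → Terms ss → Set
  data Ctx R where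
    root : ∀ {s} {t u : Term s} → R t u → Ctx R t u
    under : ∀ f {ts us} → CtxArgs R ts us → Ctx R (app f ts) (app f us)
  data CtxArgs R where
    hd : ∀ {s ss} {t u : Term s} {ts : Terms ss} → Ctx R t u → CtxArgs R (t ∷ ts) (u ∷ ts)
    tl : ∀ {s ss} {t : Term s} {ts us : Terms ss} → CtxArgs R ts us → CtxArgs R (t ∷ ts) (t ∷ us)

  data Pointwise (R : TRel) : ∀ {ss} → Terms ss → Terms ss → Set where
    []  : Pointwise R [] []
    _∷_ : ∀ {s ss} {t u : Term s} {ts us : Terms ss} →
          R t u → Pointwise R ts us → Pointwise R (t ∷ ts) (u ∷ us)

  record CE : Set₁ where
    field
      sort : Sort
      lhs  : Term sort
      rhs  : Term sort
      X    : VarSet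
      φ    : Term (inj₁ boolS)
      φTh  : IsThTerm φ
      φVars : VarsIn φ ⊆ X

  record IsCongruence (R : TRel) : Set where
    field
      reflexive  : ∀ {s} (t : Term s) → R t t
      symmetric  : ∀ {s} {t u : Term s} → R t u → R u t
      transitive : ∀ {s} {t u v : Term s} → R t u → R u v → R t v
      compatible : ∀ (f : Fun) {ts us : Terms (args f)} →
                   Pointwise R ts us → R (app f ts) (app f us)

-- the set E of CEs is given as an indexed family  ℰ : Ix → CE
module Theory (Sig : Signature) (M : Model Sig) (Ix : Set) (ℰ : Ix → Terms.CE Sig) where
  open Signature Sig
  open Model M
  open Terms Sig

  Valuation : Set
  Valuation = ∀ {τ} → VTh τ → I τ

  data Eval (ρ : Valuation) : ∀ {τ} → Term (inj₁ τ) → I τ → Set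
  data EvalArgs (ρ : Valuation) : (ss : List ThSort) → Terms (map inj₁ ss) → All I ss → Set
  data Eval ρ where
    evar : ∀ {τ} (x : VTh τ) → Eval ρ (var (thv x)) (ρ x)
    eapp : ∀ (f : FTh) {ts vs} → EvalArgs ρ (thArgs f) ts vs → Eval ρ (app (inj₁ f) ts) (J f vs)
  data EvalArgs ρ where
    []  : EvalArgs ρ [] [] All.[]
    _∷_ : ∀ {τ ss} {t : Term (inj₁ τ)} {ts v vs} →
          Eval ρ t v → EvalArgs ρ ss ts vs → EvalArgs ρ (τ ∷ ss) (t ∷ ts) (v All.∷ vs)

  ⊨_ : Term (inj₁ boolS) → Set
  ⊨ φ = ∀ (ρ : Valuation) → Σ[ v ∈ I boolS ] (Eval ρ φ v × Inverse.to boolIso v ≡ true)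

  data IsValue : ∀ {τ} → Term (inj₁ τ) → Set where
    isv : ∀ {c} → isVal c → (ts : Terms (map inj₁ (thArgs c))) → IsValue (app (inj₁ c) ts)

  data AllValues : (ss : List ThSort) → Terms (map inj₁ ss) → Set where
    []  : AllValues [] []
    _∷_ : ∀ {τ ss} {t : Term (inj₁ τ)} {ts} → IsValue t → AllValues ss ts → AllValues (τ ∷ ss) (t ∷ ts)

  _-valued_ : VarSet → Subst → Set
  X -valued σ = ∀ {τ} (x : VTh τ) → X τ x → IsValue (σ · thv x)

  data CalcRoot : TRel where
    calc : ∀ (f : FTh) → ¬ isVal f → ∀ {cs : Terms (map inj₁ (thArgs f))} →
           AllValues (thArgs f) cs →
           ∀ {c0 : Term (inj₁ (thRes f))} → IsValue c0 →
           (∀ (ρ : Valuation) → Σ[ vs ∈ All I (thArgs f) ]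
              (EvalArgs ρ (thArgs f) cs vs × Eval ρ c0 (J f vs))) →
           CalcRoot (app (inj₁ f) cs) c0

  data RuleRoot : TRel where
    rule : ∀ (i : Ix) (σ : Subst) → CE.X (ℰ i) -valued σ → ⊨ (CE.φ (ℰ i) ⟨ σ ⟩) →
           RuleRoot (CE.lhs (ℰ i) ⟨ σ ⟩) (CE.rhs (ℰ i) ⟨ σ ⟩)

  _↔E_ : TRel
  s ↔E t = Ctx CalcRoot s t ⊎ Ctx CalcRoot t s ⊎ Ctx RuleRoot s t ⊎ Ctx RuleRoot t s

  _↔E*_ : TRel
  _↔E*_ {s} = Star (_↔E_ {s})

  cec : VarSet → Term (inj₁ boolS) → TRel
  cec X φ s t = ∀ (σ : Subst) → X -valued σ → ⊨ (φ ⟨ σ ⟩) → (s ⟨ σ ⟩) ↔E* (t ⟨ σ ⟩)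

-- Each ↔E-step is a contextual closure, so it can be replayed under any
-- argument position; hence ↔E* is a congruence on terms. The relation
-- ⊨cec Π X. s ≈ t [φ] asks for s σ ↔E* t σ at each admissible σ, and
-- since substitution commutes with function application it inherits
-- all four congruence properties pointwise in σ.
module Submission where

open import Defs
open import Data.Sum using (inj₁; inj₂; _⊎_)
import Data.Sum as Sum
open import Relation.Binary.Construct.Closure.ReflexiveTransitive
  using (Star; ε; _◅_; _◅◅_; gmap; reverse)

module _ (Sig : Signature) (M : Model Sig) (Ix : Set) (ℰ : Ix → Terms.CE Sig) where
  open Signature Sig
  open Terms Sig
  open Theory Sig M Ix ℰ

  ↔E-sym : ∀ {s} {t u : Term s} → t ↔E u → u ↔E t
  ↔E-sym (inj₁ p)               = inj₂ (inj₁ p)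
  ↔E-sym (inj₂ (inj₁ p))        = inj₁ p
  ↔E-sym (inj₂ (inj₂ (inj₁ p))) = inj₂ (inj₂ (inj₂ p))
  ↔E-sym (inj₂ (inj₂ (inj₂ p))) = inj₂ (inj₂ (inj₁ p))

  _↔Es_ : ∀ {ss} → Terms ss → Terms ss → Set
  ts ↔Es us = CtxArgs CalcRoot ts us ⊎ CtxArgs CalcRoot us ts
            ⊎ CtxArgs RuleRoot ts us ⊎ CtxArgs RuleRoot us ts

  _↔Es*_ : ∀ {ss} → Terms ss → Terms ss → Set
  _↔Es*_ {ss} = Star (_↔Es_ {ss})

  ↔E-hd : ∀ {s ss} {t u : Term s} {ts : Terms ss} → t ↔E u → (t ∷ ts) ↔Es (u ∷ ts)
  ↔E-hd = Sum.map hd (Sum.map hd (Sum.map hd hd))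

  ↔Es-tl : ∀ {s ss} {t : Term s} {ts us : Terms ss} → ts ↔Es us → (t ∷ ts) ↔Es (t ∷ us)
  ↔Es-tl = Sum.map tl (Sum.map tl (Sum.map tl tl))

  ↔Es-under : ∀ f {ts us : Terms (args f)} → ts ↔Es us → app f ts ↔E app f us
  ↔Es-under f = Sum.map (under f) (Sum.map (under f) (Sum.map (under f) (under f)))

  ↔E*-∷ : ∀ {s ss} {t u : Term s} {ts us : Terms ss} →
          t ↔E* u → ts ↔Es* us → (t ∷ ts) ↔Es* (u ∷ us)
  ↔E*-∷ t↔u ts↔us = gmap (_∷ _) ↔E-hd t↔u ◅◅ gmap (_ ∷_) ↔Es-tl ts↔us

  pointwise-↔E*⇒↔Es* : ∀ {ss} {ts us : Terms ss} → Pointwise _↔E*_ ts us → ts ↔Es* us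
  pointwise-↔E*⇒↔Es* []              = ε
  pointwise-↔E*⇒↔Es* (t↔u ∷ ts↔us) = ↔E*-∷ t↔u (pointwise-↔E*⇒↔Es* ts↔us)

  ↔E*-isCongruence : IsCongruence _↔E*_
  ↔E*-isCongruence = record
    { reflexive  = λ _ → ε
    ; symmetric  = reverse ↔E-sym
    ; transitive = _◅◅_
    ; compatible = λ f ts↔us → gmap (app f) (↔Es-under f) (pointwise-↔E*⇒↔Es* ts↔us)
    }

  pointwise-⟨⟩* : ∀ {R S : TRel} (σ : Subst) →
                  (∀ {s} {t u : Term s} → R t u → S (t ⟨ σ ⟩) (u ⟨ σ ⟩)) →
                  ∀ {ss} {ts us : Terms ss} → Pointwise R ts us → Pointwise S (ts ⟨ σ ⟩*) (us ⟨ σ ⟩*)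
  pointwise-⟨⟩* σ inst []            = []
  pointwise-⟨⟩* σ inst (t≈u ∷ ts≈us) = inst t≈u ∷ pointwise-⟨⟩* σ inst ts≈us

  cec-isCongruence : (X : VarSet) (φ : Term (inj₁ boolS)) → IsCongruence (cec X φ)
  cec-isCongruence X φ = record
    { reflexive  = λ t σ _ _ → reflexive (t ⟨ σ ⟩)
    ; symmetric  = λ t≈u σ σX σφ → symmetric (t≈u σ σX σφ)
    ; transitive = λ t≈u u≈v σ σX σφ → transitive (t≈u σ σX σφ) (u≈v σ σX σφ)
    ; compatible = λ f ts≈us σ σX σφ →
        compatible f (pointwise-⟨⟩* σ (λ t≈u → t≈u σ σX σφ) ts≈us)
    }
    where open IsCongruence ↔E*-isCongruence

lemma15 : (Sig : Signature) (M : Model Sig) (Ix : Set) (ℰ : Ix → Terms.CE Sig) →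
    let open Signature Sig in
    let open Terms Sig in
    let open Theory Sig M Ix ℰ in
    (X : VarSet) (φ : Term (inj₁ boolS)) → IsThTerm φ → VarsIn φ ⊆ X →
    IsCongruence (cec X φ)
lemma15 Sig M Ix ℰ X φ _ _ = cec-isCongruence Sig M Ix ℰ X φ
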